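{- Let $\lesssim$ be a plausible preorder on $\mathcal{T}$ and $E(\cdot|\cdot)$ the conditional expectation naturally induced by it. Let $X$ be a random quantity and $C,D$ events. Suppose $E(X|C.D)\in\{ -\infty,+\infty\}$ and there is a positive real number $p$ such that $p\lesssim_D C$. Then $E(X.C|D)=E(X|C.D)$.
   Context: Random quantities: $\mathcal{T}$ is a unital associative commutative algebra over $\mathbb{R}$; reals $r$ are identified with $r\mathbf{1}$; products are written $X.Y$. Events: idempotents $A$ ($A.A=A$). Plausible preorder: a relation $\lesssim$ on $\mathcal{T}$ with (i) $0\lesssim A$ for every event $A$; (ii) $0\lesssim X$ and $0\lesssim Y$ imply $0\lesssim X+Y$; (iii) $0\lesssim X$ and real $q\ge0$ imply $0\lesssim qX$; (iv) $X\lesssim Y$ iff $0\lesssim Y-X$. Strict part: $X\lnsim Y$ iff $X\lesssim Y$ and not $Y\lesssim X$. Conditional preorder: $X\lesssim_C Y$ iff $X.C\lesssim Y.C$; strict part $\lnsim_C$. Expectation induced by a plausible preorder: $E(X)$ is the real $x$ if $-\epsilon\lnsim X-x\lnsim\epsilon$ for all reals $\epsilon>0$; it is $+\infty$ if $y\lnsim X$ for all reals $y$; it is $-\infty$ if $X\lnsim y$ for all reals $y$; it is undefined otherwise. Conditional expectation: $E(X|C)$ is the expectation induced by $\lesssim_C$. -}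

module Defs where

open import Level using (0ℓ)
open import Data.Product using (Σ; ∃; _×_; _,_)
open import Data.Sum using (_⊎_)
open import Relation.Nullary using (¬_)
open import Relation.Binary.PropositionalEquality using (_≡_; _≢_)
open import Relation.Binary.Structures using (IsTotalOrder)
open import Algebra.Structures using (IsCommutativeRing)

-- The real numbers.  agda-stdlib has no reals, so ℝ is taken to be an
-- arbitrary model of the axioms of the reals: a Dedekind-complete
-- ordered field (unique up to isomorphism).

record RealNumbers : Set₁ where
  infixl 6 _+_
  infixl 7 _*_
  infix  4 _≤_ _<_
  field
    ℝ      : Set
    _+_    : ℝ → ℝ → ℝ
    _*_    : ℝ → ℝ → ℝ
    -_     : ℝ → ℝ
    0ℝ     : ℝ
    1ℝ     : ℝ
    isCommutativeRing : IsCommutativeRing _≡_ _+_ _*_ -_ 0ℝ 1ℝ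
    0≢1    : 0ℝ ≢ 1ℝ
    inverse : ∀ x → x ≢ 0ℝ → ∃ λ y → x * y ≡ 1ℝ
    _≤_    : ℝ → ℝ → Set
    isTotalOrder : IsTotalOrder _≡_ _≤_
    +-mono-≤ : ∀ {x y} z → x ≤ y → x + z ≤ y + z
    *-nonneg : ∀ {x y} → 0ℝ ≤ x → 0ℝ ≤ y → 0ℝ ≤ x * y
    complete : (S : ℝ → Set) → ∃ S → (∃ λ b → ∀ x → S x → x ≤ b) →
               ∃ λ s → (∀ x → S x → x ≤ s) × (∀ b → (∀ x → S x → x ≤ b) → s ≤ b)

  _<_ : ℝ → ℝ → Set
  x < y = x ≤ y × x ≢ y

-- Random quantities: a unital associative commutative algebra 𝒯 over ℝ,
-- presented as a commutative ring with a unital ring homomorphism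
-- ι : ℝ → 𝒯 (the real r is identified with r·1 = ι r, and the scalar
-- multiplication is q X = ι q . X).

record Algebra (R : RealNumbers) : Set₁ where
  open RealNumbers R using (ℝ) renaming (_+_ to _+ℝ_; _*_ to _*ℝ_; 1ℝ to 1ℝ)
  infixl 6 _+_ _-_
  infixl 7 _∙_
  field
    𝒯   : Set
    _+_ : 𝒯 → 𝒯 → 𝒯
    _∙_ : 𝒯 → 𝒯 → 𝒯
    -_  : 𝒯 → 𝒯
    𝟎   : 𝒯
    𝟏   : 𝒯
    isCommutativeRing : IsCommutativeRing _≡_ _+_ _∙_ -_ 𝟎 𝟏
    ι     : ℝ → 𝒯
    ι-+   : ∀ a b → ι (a +ℝ b) ≡ ι a + ι b
    ι-*   : ∀ a b → ι (a *ℝ b) ≡ ι a ∙ ι b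
    ι-1   : ι 1ℝ ≡ 𝟏

  _-_ : 𝒯 → 𝒯 → 𝒯
  X - Y = X + (- Y)

  _·_ : ℝ → 𝒯 → 𝒯
  q · X = ι q ∙ X

  IsEvent : 𝒯 → Set
  IsEvent A = A ∙ A ≡ A

module _ {R : RealNumbers} (𝒜 : Algebra R) where
  open RealNumbers R using (ℝ; 0ℝ; _≤_; _<_)
  open Algebra 𝒜

  record IsPlausiblePreorder (_≲_ : 𝒯 → 𝒯 → Set) : Set where
    field
      event-nonneg : ∀ A → IsEvent A → 𝟎 ≲ A
      sum-nonneg   : ∀ X Y → 𝟎 ≲ X → 𝟎 ≲ Y → 𝟎 ≲ (X + Y)
      scale-nonneg : ∀ X q → 𝟎 ≲ X → 0ℝ ≤ q → 𝟎 ≲ (q · X)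
      diff-to      : ∀ X Y → X ≲ Y → 𝟎 ≲ (Y - X)
      diff-from    : ∀ X Y → 𝟎 ≲ (Y - X) → X ≲ Y

  Strict : (𝒯 → 𝒯 → Set) → 𝒯 → 𝒯 → Set
  Strict _≲_ X Y = X ≲ Y × ¬ (Y ≲ X)

  Cond : (𝒯 → 𝒯 → Set) → 𝒯 → 𝒯 → 𝒯 → Set
  Cond _≲_ C X Y = (X ∙ C) ≲ (Y ∙ C)

  data ℝ̄ : Set where
    fin  : ℝ → ℝ̄
    +∞   : ℝ̄
    -∞   : ℝ̄

  -- HasExpectation _≲_ X e : the expectation of X induced by _≲_ is
  -- defined and equals e.  (E(X) is undefined iff no e satisfies this.)
  HasExpectation : (𝒯 → 𝒯 → Set) → 𝒯 → ℝ̄ → Set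
  HasExpectation _≲_ X (fin x) =
    ∀ (ε : ℝ) → 0ℝ < ε →
      Strict _≲_ (ι (RealNumbers.-_ R ε)) (X - ι x) × Strict _≲_ (X - ι x) (ι ε)
  HasExpectation _≲_ X +∞ = ∀ (y : ℝ) → Strict _≲_ (ι y) X
  HasExpectation _≲_ X -∞ = ∀ (y : ℝ) → Strict _≲_ X (ι y)

  HasCondExpectation : (𝒯 → 𝒯 → Set) → 𝒯 → 𝒯 → ℝ̄ → Set
  HasCondExpectation _≲_ X C e = HasExpectation (Cond _≲_ C) X e

-- Since D is an event, ≲_D is again a plausible preorder, and the hypothesis reads p ≲_D C;
-- scaling by z ≥ 0 gives z p ≲_D z C, hence every real is ≲_D-below some real multiple of C
-- and ≲_D-above another one.  Moreover z C ≲_D X.C is the same statement as z ≲_{C.D} X.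
-- If E(X|C.D) = +∞ then X.C lies strictly ≲_D-above every multiple of C, hence strictly above
-- every real, so E(X.C|D) = +∞; the case −∞ is symmetric.

module Submission where

open import Defs
open import Data.Product using (∃; _×_; _,_)
open import Data.Sum using (_⊎_; inj₁; inj₂)
open import Function using (_∘_; id)
open import Relation.Binary.Definitions using (Transitive)
open import Relation.Binary.PropositionalEquality
  using (_≡_; refl; sym; trans; cong; cong₂; subst; subst₂; module ≡-Reasoning)
open import Relation.Binary.Structures using (IsTotalOrder)
open import Algebra.Bundles using (CommutativeRing)

module RealNumbersProperties (R : RealNumbers) where
  open RealNumbers R

  commutativeRing : CommutativeRing _ _
  commutativeRing = record { isCommutativeRing = isCommutativeRing }

  open CommutativeRing commutativeRing
    using (+-identityˡ; -‿inverseʳ; *-identityʳ; *-comm; *-assoc; zeroˡ; ring)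
  open import Algebra.Properties.Ring ring using (-‿distribˡ-*; -‿distribʳ-*; -‿involutive)
  open IsTotalOrder isTotalOrder using (total; reflexive)
  open ≡-Reasoning

  x≤y⇒0≤y-x : ∀ {x y} → x ≤ y → 0ℝ ≤ y + - x
  x≤y⇒0≤y-x {x} x≤y = subst (_≤ _) (-‿inverseʳ x) (+-mono-≤ (- x) x≤y)

  x≤0⇒0≤-x : ∀ {x} → x ≤ 0ℝ → 0ℝ ≤ - x
  x≤0⇒0≤-x {x} x≤0 = subst (0ℝ ≤_) (+-identityˡ (- x)) (x≤y⇒0≤y-x x≤0)

  -x*-x≡x*x : ∀ x → - x * - x ≡ x * x
  -x*-x≡x*x x = begin
    - x * - x     ≡⟨ -‿distribˡ-* x (- x) ⟨
    - (x * - x)   ≡⟨ cong -_ (-‿distribʳ-* x x) ⟨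
    - - (x * x)   ≡⟨ -‿involutive (x * x) ⟩
    x * x         ∎

  x*x-nonneg : ∀ x → 0ℝ ≤ x * x
  x*x-nonneg x with total 0ℝ x
  ... | inj₁ 0≤x = *-nonneg 0≤x 0≤x
  ... | inj₂ x≤0 = subst (0ℝ ≤_) (-x*-x≡x*x x) (*-nonneg (x≤0⇒0≤-x x≤0) (x≤0⇒0≤-x x≤0))

  -- w = w (p w) = p w², a product of nonnegatives.
  inverse-nonneg : ∀ {p w} → 0ℝ ≤ p → p * w ≡ 1ℝ → 0ℝ ≤ w
  inverse-nonneg {p} {w} 0≤p pw≡1 = subst (0ℝ ≤_) pw²≡w (*-nonneg 0≤p (x*x-nonneg w))
    where
    pw²≡w : p * (w * w) ≡ w
    pw²≡w = begin
      p * (w * w)   ≡⟨ *-assoc p w w ⟨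
      p * w * w     ≡⟨ cong (_* w) pw≡1 ⟩
      1ℝ * w        ≡⟨ *-comm 1ℝ w ⟩
      w * 1ℝ        ≡⟨ *-identityʳ w ⟩
      w             ∎

  nonneg-multiple-≥ : ∀ {p} → 0ℝ < p → ∀ y → ∃ λ z → 0ℝ ≤ z × y ≤ z * p
  nonneg-multiple-≥ {p} (0≤p , 0≢p) y with total 0ℝ y
  ... | inj₂ y≤0 = 0ℝ , reflexive refl , subst (y ≤_) (sym (zeroˡ p)) y≤0
  ... | inj₁ 0≤y with inverse p (0≢p ∘ sym)
  ...   | w , pw≡1 = y * w , *-nonneg 0≤y (inverse-nonneg 0≤p pw≡1) , reflexive (sym ywp≡y)
    where
    ywp≡y : y * w * p ≡ y
    ywp≡y = begin
      y * w * p     ≡⟨ *-assoc y w p ⟩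
      y * (w * p)   ≡⟨ cong (y *_) (trans (*-comm w p) pw≡1) ⟩
      y * 1ℝ        ≡⟨ *-identityʳ y ⟩
      y             ∎

module AlgebraProperties {R : RealNumbers} (𝒜 : Algebra R) where
  open RealNumbers R using (0ℝ) renaming (-_ to -ℝ_; _+_ to _+ℝ_)
  open Algebra 𝒜

  commutativeRing : CommutativeRing _ _
  commutativeRing = record { isCommutativeRing = isCommutativeRing }

  open CommutativeRing commutativeRing
    using (+-identityˡ; -‿inverseˡ; +-comm; +-assoc; *-commutativeSemigroup; ring)
  open import Algebra.Properties.Ring ring using (x+x≈x⇒x≈0; +-inverseˡ-unique; -‿involutive)
  open import Algebra.Properties.CommutativeSemigroup *-commutativeSemigroup using (interchange)
  open CommutativeRing (RealNumbersProperties.commutativeRing R)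
    using () renaming (+-identityˡ to +ℝ-identityˡ; -‿inverseˡ to -ℝ‿inverseˡ)
  open ≡-Reasoning

  ι-0 : ι 0ℝ ≡ 𝟎
  ι-0 = x+x≈x⇒x≈0 (ι 0ℝ) (trans (sym (ι-+ 0ℝ 0ℝ)) (cong ι (+ℝ-identityˡ 0ℝ)))

  ι-neg : ∀ a → ι (-ℝ a) ≡ - ι a
  ι-neg a = +-inverseˡ-unique (ι (-ℝ a)) (ι a)
    (trans (sym (ι-+ (-ℝ a) a)) (trans (cong ι (-ℝ‿inverseˡ a)) ι-0))

  ι-- : ∀ a b → ι (a +ℝ -ℝ b) ≡ ι a - ι b
  ι-- a b = trans (ι-+ a (-ℝ b)) (cong (ι a +_) (ι-neg b))

  ∙-event : ∀ {A B} → IsEvent A → IsEvent B → IsEvent (A ∙ B)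
  ∙-event {A} {B} AA≡A BB≡B = trans (interchange A B A B) (cong₂ _∙_ AA≡A BB≡B)

  𝟏-event : IsEvent 𝟏
  𝟏-event = CommutativeRing.*-identityˡ commutativeRing 𝟏

  diff-telescope : ∀ X Y Z → (Y - X) + (Z - Y) ≡ Z - X
  diff-telescope X Y Z = begin
    (Y - X) + (Z - Y)    ≡⟨ +-comm (Y - X) (Z - Y) ⟩
    (Z - Y) + (Y - X)    ≡⟨ +-assoc Z (- Y) (Y - X) ⟩
    Z + (- Y + (Y - X))  ≡⟨ cong (Z +_) (+-assoc (- Y) Y (- X)) ⟨
    Z + ((- Y + Y) - X)  ≡⟨ cong (λ U → Z + (U - X)) (-‿inverseˡ Y) ⟩
    Z + (𝟎 - X)          ≡⟨ cong (Z +_) (+-identityˡ (- X)) ⟩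
    Z - X                ∎

  diff-neg : ∀ X Y → Y - X ≡ (- X) - (- Y)
  diff-neg X Y = trans (+-comm Y (- X)) (cong (- X +_) (sym (-‿involutive Y)))

module StrictPartProperties {R : RealNumbers} (𝒜 : Algebra R)
  (_≲_ : Algebra.𝒯 𝒜 → Algebra.𝒯 𝒜 → Set) (≲-trans : Transitive _≲_) where

  ≲-<-trans : ∀ {X Y Z} → X ≲ Y → Strict 𝒜 _≲_ Y Z → Strict 𝒜 _≲_ X Z
  ≲-<-trans X≲Y (Y≲Z , Z≴Y) = ≲-trans X≲Y Y≲Z , λ Z≲X → Z≴Y (≲-trans Z≲X X≲Y)

  <-≲-trans : ∀ {X Y Z} → Strict 𝒜 _≲_ X Y → Y ≲ Z → Strict 𝒜 _≲_ X Z
  <-≲-trans (X≲Y , Y≴X) Y≲Z = ≲-trans X≲Y Y≲Z , λ Z≲X → Y≴X (≲-trans Y≲Z Z≲X)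

module PlausiblePreorderProperties {R : RealNumbers} {𝒜 : Algebra R}
  {_≲_ : Algebra.𝒯 𝒜 → Algebra.𝒯 𝒜 → Set} (isPlausible : IsPlausiblePreorder 𝒜 _≲_) where
  open RealNumbers R using (ℝ; 0ℝ; _≤_; _<_) renaming (-_ to -ℝ_)
  open RealNumbersProperties R using (x≤y⇒0≤y-x; nonneg-multiple-≥)
  open Algebra 𝒜
  open AlgebraProperties 𝒜
  open CommutativeRing commutativeRing using (*-identityʳ; ring)
  open import Algebra.Properties.Ring ring using (x[y-z]≈xy-xz; -‿distribˡ-*; -‿involutive)
  open IsPlausiblePreorder isPlausible

  ≲-trans : Transitive _≲_
  ≲-trans {X} {Y} {Z} X≲Y Y≲Z = diff-from X Z
    (subst (𝟎 ≲_) (diff-telescope X Y Z) (sum-nonneg _ _ (diff-to X Y X≲Y) (diff-to Y Z Y≲Z)))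

  neg-antitone : ∀ {X Y} → X ≲ Y → (- Y) ≲ (- X)
  neg-antitone {X} {Y} X≲Y = diff-from (- Y) (- X) (subst (𝟎 ≲_) (diff-neg X Y) (diff-to X Y X≲Y))

  ι-mono : ∀ {x y} → x ≤ y → ι x ≲ ι y
  ι-mono {x} {y} x≤y = diff-from (ι x) (ι y)
    (subst (𝟎 ≲_) (trans (*-identityʳ _) (ι-- y x))
      (scale-nonneg 𝟏 _ (event-nonneg 𝟏 𝟏-event) (x≤y⇒0≤y-x x≤y)))

  ·-monoʳ : ∀ {q X Y} → 0ℝ ≤ q → X ≲ Y → (q · X) ≲ (q · Y)
  ·-monoʳ {q} {X} {Y} 0≤q X≲Y = diff-from _ _
    (subst (𝟎 ≲_) (x[y-z]≈xy-xz (ι q) Y X) (scale-nonneg (Y - X) q (diff-to X Y X≲Y) 0≤q))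

  module _ {p : ℝ} {C : 𝒯} (0<p : 0ℝ < p) (p≲C : ι p ≲ C) where

    below-multiple : ∀ y → ∃ λ z → ι y ≲ (z · C)
    below-multiple y with nonneg-multiple-≥ 0<p y
    ... | z , 0≤z , y≤zp = z , ≲-trans (subst (ι y ≲_) (ι-* z p) (ι-mono y≤zp)) (·-monoʳ 0≤z p≲C)

    above-multiple : ∀ y → ∃ λ z → (z · C) ≲ ι y
    above-multiple y with below-multiple (-ℝ y)
    ... | z , -y≲zC = -ℝ z , subst₂ _≲_ -[zC]≡[-z]C -ι[-y]≡ιy (neg-antitone -y≲zC)
      where
      -[zC]≡[-z]C : - (z · C) ≡ (-ℝ z) · C
      -[zC]≡[-z]C = trans (-‿distribˡ-* (ι z) C) (cong (_∙ C) (sym (ι-neg z)))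
      -ι[-y]≡ιy : - ι (-ℝ y) ≡ ι y
      -ι[-y]≡ιy = trans (cong -_ (ι-neg y)) (-‿involutive (ι y))

module ConditionalPreorderProperties {R : RealNumbers} {𝒜 : Algebra R}
  {_≲_ : Algebra.𝒯 𝒜 → Algebra.𝒯 𝒜 → Set} where
  open Algebra 𝒜
  open AlgebraProperties 𝒜
  open CommutativeRing commutativeRing using (*-assoc; distribʳ; zeroˡ; ring)
  open import Algebra.Properties.Ring ring using ([y-z]x≈yx-zx)

  cond-isPlausiblePreorder : IsPlausiblePreorder 𝒜 _≲_ → ∀ {D} → IsEvent D →
                             IsPlausiblePreorder 𝒜 (Cond 𝒜 _≲_ D)
  cond-isPlausiblePreorder isPlausible {D} D-event = record
    { event-nonneg = λ A A-event → from𝟎 (event-nonneg _ (∙-event A-event D-event))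
    ; sum-nonneg   = λ X Y 0≲X 0≲Y →
        from𝟎 (subst (𝟎 ≲_) (sym (distribʳ D X Y)) (sum-nonneg _ _ (to𝟎 0≲X) (to𝟎 0≲Y)))
    ; scale-nonneg = λ X q 0≲X 0≤q →
        from𝟎 (subst (𝟎 ≲_) (sym (*-assoc (ι q) X D)) (scale-nonneg _ q (to𝟎 0≲X) 0≤q))
    ; diff-to      = λ X Y X≲Y → from𝟎 (subst (𝟎 ≲_) (sym ([y-z]x≈yx-zx D Y X)) (diff-to _ _ X≲Y))
    ; diff-from    = λ X Y 0≲Y-X → diff-from _ _ (subst (𝟎 ≲_) ([y-z]x≈yx-zx D Y X) (to𝟎 0≲Y-X))
    }
    where
    open IsPlausiblePreorder isPlausible
    from𝟎 : ∀ {X} → 𝟎 ≲ (X ∙ D) → Cond 𝒜 _≲_ D 𝟎 X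
    from𝟎 = subst (_≲ _) (sym (zeroˡ D))
    to𝟎 : ∀ {X} → Cond 𝒜 _≲_ D 𝟎 X → 𝟎 ≲ (X ∙ D)
    to𝟎 = subst (_≲ _) (zeroˡ D)

  cond-∙-≡ : ∀ {C D Y Z} → Cond 𝒜 _≲_ (C ∙ D) Y Z ≡ Cond 𝒜 _≲_ D (Y ∙ C) (Z ∙ C)
  cond-∙-≡ {C} {D} {Y} {Z} = cong₂ _≲_ (sym (*-assoc Y C D)) (sym (*-assoc Z C D))

  strict-cond-∙ : ∀ {C D Y Z} → Strict 𝒜 (Cond 𝒜 _≲_ (C ∙ D)) Y Z →
                  Strict 𝒜 (Cond 𝒜 _≲_ D) (Y ∙ C) (Z ∙ C)
  strict-cond-∙ (Y≲Z , Z≴Y) = subst id cond-∙-≡ Y≲Z , Z≴Y ∘ subst id (sym cond-∙-≡)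

module ConditionalExpectationOfProduct {R : RealNumbers} {𝒜 : Algebra R}
  {_≲_ : Algebra.𝒯 𝒜 → Algebra.𝒯 𝒜 → Set} (isPlausible : IsPlausiblePreorder 𝒜 _≲_)
  {C D : Algebra.𝒯 𝒜} (D-event : Algebra.IsEvent 𝒜 D)
  {p : RealNumbers.ℝ R} (0<p : RealNumbers._<_ R (RealNumbers.0ℝ R) p)
  (p≲C : Cond 𝒜 _≲_ D (Algebra.ι 𝒜 p) C) where
  open Algebra 𝒜 using (_∙_)
  open ConditionalPreorderProperties {𝒜 = 𝒜} {_≲_ = _≲_} using (cond-isPlausiblePreorder; strict-cond-∙)
  open PlausiblePreorderProperties (cond-isPlausiblePreorder isPlausible D-event)
  open StrictPartProperties 𝒜 (Cond 𝒜 _≲_ D) ≲-trans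

  +∞-cond-∙ : ∀ {X} → HasCondExpectation 𝒜 _≲_ X (C ∙ D) +∞ →
              HasCondExpectation 𝒜 _≲_ (X ∙ C) D +∞
  +∞-cond-∙ E≡+∞ y with below-multiple 0<p p≲C y
  ... | z , y≲zC = ≲-<-trans y≲zC (strict-cond-∙ (E≡+∞ z))

  -∞-cond-∙ : ∀ {X} → HasCondExpectation 𝒜 _≲_ X (C ∙ D) -∞ →
              HasCondExpectation 𝒜 _≲_ (X ∙ C) D -∞
  -∞-cond-∙ E≡-∞ y with above-multiple 0<p p≲C y
  ... | z , zC≲y = <-≲-trans (strict-cond-∙ (E≡-∞ z)) zC≲y

mainTheorem5 :
    (R : RealNumbers) (𝒜 : Algebra R) →
    (_≲_ : Algebra.𝒯 𝒜 → Algebra.𝒯 𝒜 → Set) → IsPlausiblePreorder 𝒜 _≲_ →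
    (X C D : Algebra.𝒯 𝒜) → Algebra.IsEvent 𝒜 C → Algebra.IsEvent 𝒜 D →
    (e : ℝ̄ 𝒜) → (e ≡ +∞ ⊎ e ≡ -∞) →
    HasCondExpectation 𝒜 _≲_ X (Algebra._∙_ 𝒜 C D) e →
    (∃ λ (p : RealNumbers.ℝ R) →
       RealNumbers._<_ R (RealNumbers.0ℝ R) p × Cond 𝒜 _≲_ D (Algebra.ι 𝒜 p) C) →
    HasCondExpectation 𝒜 _≲_ (Algebra._∙_ 𝒜 X C) D e
mainTheorem5 _ _ _ isPlausible _ _ _ _ D-event .+∞ (inj₁ refl) E≡+∞ (_ , 0<p , p≲C) =
  ConditionalExpectationOfProduct.+∞-cond-∙ isPlausible D-event 0<p p≲C E≡+∞
mainTheorem5 _ _ _ isPlausible _ _ _ _ D-event .-∞ (inj₂ refl) E≡-∞ (_ , 0<p , p≲C) =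
  ConditionalExpectationOfProduct.-∞-cond-∙ isPlausible D-event 0<p p≲C E≡-∞
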